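{- For two reflexive presentations $P$ and $Q$, the presented monoids $\overline P$ and $\overline Q$ are isomorphic if and only if there exist a reflexive presentation $R$ and morphisms $P\to R$ and $Q\to R$ in $\mathbf{rPres}$ which both belong to $\mathrm{cell}(\mathcal J)$ (generalized Tietze transformations).
   Context: A presentation $P$ consists of a set $P_1$ of generators and a set $P_2\subseteq P_1^*\times P_1^*$ of relations ($P_1^*$ the free monoid of words on $P_1$); a relation $(u,v)$ is written $u\Rightarrow v$. $\overline P=P_1^*/{\sim_P}$, where $\sim_P$ is the congruence generated by $P_2$. A morphism $f:P\to Q$ is a function $f:P_1\to Q_1$ with $f^*(u)\Rightarrow f^*(v)\in Q_2$ for all $u\Rightarrow v\in P_2$. $P$ is reflexive if $u\Rightarrow u\in P_2$ for all words $u$; $\mathbf{rPres}$ is the full subcategory of reflexive presentations (it is cocomplete). Convention: a reflexive presentation written $\langle\text{generators}\mid\text{relations}\rangle$ additionally contains all reflexivity relations $u\Rightarrow u$. $\mathcal J$ is the class of the following inclusions in $\mathbf{rPres}$, for $m,n,p,q\in\mathbb N$, with $u=a_1\cdots a_m$, $v=a_{m+1}\cdots a_{m+n}$, $w=a_{m+n+1}\cdots a_{m+n+p}$, $w'=a_{m+n+p+1}\cdots a_{m+n+p+q}$: (1) $\langle a_1,\dots,a_m\mid\rangle\hookrightarrow\langle a_1,\dots,a_{m+1}\mid u\Rightarrow a_{m+1}\rangle$; (2) $\langle a_1,\dots,a_m\mid\rangle\hookrightarrow\langle a_1,\dots,a_m\mid u\Rightarrow u\rangle$; (3) $\langle a_1,\dots,a_{m+n}\mid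 u\Rightarrow v\rangle\hookrightarrow\langle a_1,\dots,a_{m+n}\mid u\Rightarrow v, v\Rightarrow u\rangle$; (4) $\langle a_1,\dots,a_{m+n+p}\mid u\Rightarrow v,v\Rightarrow w\rangle\hookrightarrow\langle a_1,\dots,a_{m+n+p}\mid u\Rightarrow v,v\Rightarrow w,u\Rightarrow w\rangle$; (5) $\langle a_1,\dots,a_{m+n+p+q}\mid u\Rightarrow v\rangle\hookrightarrow\langle a_1,\dots,a_{m+n+p+q}\mid u\Rightarrow v, wuw'\Rightarrow wvw'\rangle$. $\mathrm{cell}(\mathcal J)$ is the smallest class of morphisms containing $\mathcal J$ and closed under coproducts, pushouts and countable compositions (i.e. composites of pushouts of coproducts of elements of $\mathcal J$, including transfinite-free $\omega$-indexed composites). -}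

module Defs where

open import Level using (0ℓ)
open import Data.Nat using (ℕ; suc; _+_)
open import Data.Fin using (Fin; inject₁; fromℕ; _↑ˡ_; _↑ʳ_)
open import Data.List using (List; []; _∷_; _++_; map; allFin)
open import Data.List.Properties using (map-id)
open import Data.List.Membership.Propositional using (_∈_)
open import Data.List.Membership.Propositional.Properties using (∈-++⁺ˡ)
open import Data.Product using (Σ; ∃; _×_; _,_)
open import Data.Sum using (_⊎_; inj₁; inj₂)
open import Data.Empty using (⊥)
open import Relation.Binary.PropositionalEquality using (_≡_; refl; cong; subst₂; sym)
open import Algebra.Bundles.Raw using (RawMonoid)
open import Algebra.Morphism.Structures using (module MonoidMorphisms)

record Pres : Set₁ where
  field
    Gen : Set
    _⇒_ : List Gen → List Gen → Set
open Pres public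

record RPres : Set₁ where
  field
    pres : Pres
    isRefl : ∀ (u : List (Gen pres)) → _⇒_ pres u u
open RPres public

Gn : RPres → Set
Gn P = Gen (pres P)

Rl : (P : RPres) → List (Gn P) → List (Gn P) → Set
Rl P = _⇒_ (pres P)

-- Morphisms of presentations (rPres is a full subcategory, so morphisms
-- of reflexive presentations are morphisms of the underlying presentations):
-- a function on generators whose extension f* = map f sends relations to relations.
record Hom (P Q : RPres) : Set where
  field
    fun : Gn P → Gn Q
    preserves : ∀ {u v} → Rl P u v → Rl Q (map fun u) (map fun v)
open Hom public

idH : ∀ {P} → Hom P P
idH {P} = record { fun = λ a → a
                 ; preserves = λ {u} {v} r → subst₂ (Rl P) (sym (map-id u)) (sym (map-id v)) r }

_∘H_ : ∀ {P Q R} → Hom Q R → Hom P Q → Hom P R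
_∘H_ {P} {Q} {R} g f = record
  { fun = λ a → fun g (fun f a)
  ; preserves = λ {u} {v} r →
      subst₂ (Rl R) (sym (map-∘ u)) (sym (map-∘ v)) (preserves g (preserves f r)) }
  where open import Data.List.Properties using (map-∘)

-- Equality of morphisms: equality of the underlying functions on generators
-- (the relation part is a property since P₂ is a subset).
_≈H_ : ∀ {P Q} → Hom P Q → Hom P Q → Set
f ≈H g = ∀ a → fun f a ≡ fun g a

data Cong (P : RPres) : List (Gn P) → List (Gn P) → Set where
  rel   : ∀ {u v} → Rl P u v → Cong P u v
  ∼refl : ∀ {u} → Cong P u u
  ∼sym  : ∀ {u v} → Cong P u v → Cong P v u
  ∼trans : ∀ {u v w} → Cong P u v → Cong P v w → Cong P u w
  ∼ctx  : ∀ {u v} (w w' : List (Gn P)) → Cong P u v → Cong P (w ++ u ++ w') (w ++ v ++ w')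

Presented : RPres → RawMonoid 0ℓ 0ℓ
Presented P = record
  { Carrier = List (Gn P)
  ; _≈_ = Cong P
  ; _∙_ = _++_
  ; ε = [] }

MonoidIso : RPres → RPres → Set
MonoidIso P Q = Σ (List (Gn P) → List (Gn Q)) λ f →
  MonoidMorphisms.IsMonoidIsomorphism (Presented P) (Presented Q) f

IsPushout : ∀ {A B C D} (f : Hom A B) (g : Hom A C) (f' : Hom C D) (g' : Hom B D) → Set₁
IsPushout {A} {B} {C} {D} f g f' g' =
  ((g' ∘H f) ≈H (f' ∘H g)) ×
  (∀ (E : RPres) (h : Hom B E) (k : Hom C E) → (h ∘H f) ≈H (k ∘H g) →
     Σ (Hom D E) λ u → ((u ∘H g') ≈H h) × ((u ∘H f') ≈H k) ×
       (∀ (u' : Hom D E) → (u' ∘H g') ≈H h → (u' ∘H f') ≈H k → u' ≈H u))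

IsCoproduct : ∀ {I : Set} (X : I → RPres) {S : RPres} (ι : ∀ i → Hom (X i) S) → Set₁
IsCoproduct {I} X {S} ι =
  ∀ (E : RPres) (k : ∀ i → Hom (X i) E) →
    Σ (Hom S E) λ u → (∀ i → (u ∘H ι i) ≈H k i) ×
      (∀ (u' : Hom S E) → (∀ i → (u' ∘H ι i) ≈H k i) → u' ≈H u)

IsSeqColimit : ∀ (X : ℕ → RPres) (s : ∀ n → Hom (X n) (X (suc n)))
  {L : RPres} (c : ∀ n → Hom (X n) L) → Set₁
IsSeqColimit X s {L} c =
  (∀ n → (c (suc n) ∘H s n) ≈H c n) ×
  (∀ (E : RPres) (k : ∀ n → Hom (X n) E) → (∀ n → (k (suc n) ∘H s n) ≈H k n) →
    Σ (Hom L E) λ u → (∀ n → (u ∘H c n) ≈H k n) ×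
      (∀ (u' : Hom L E) → (∀ n → (u' ∘H c n) ≈H k n) → u' ≈H u))

⟨_∣_⟩ : (k : ℕ) → List (List (Fin k) × List (Fin k)) → RPres
⟨ k ∣ rs ⟩ = record
  { pres = record { Gen = Fin k ; _⇒_ = λ u v → (u ≡ v) ⊎ ((u , v) ∈ rs) }
  ; isRefl = λ u → inj₁ refl }

inclRel : ∀ k (rs extra : List (List (Fin k) × List (Fin k))) → Hom ⟨ k ∣ rs ⟩ ⟨ k ∣ rs ++ extra ⟩
inclRel k rs extra = record
  { fun = λ a → a
  ; preserves = λ {u} {v} r → subst₂ (λ x y → (x ≡ y) ⊎ ((x , y) ∈ rs ++ extra))
                                (sym (map-id u)) (sym (map-id v)) (go r) }
  where
  go : ∀ {u v} → (u ≡ v) ⊎ ((u , v) ∈ rs) → (u ≡ v) ⊎ ((u , v) ∈ rs ++ extra)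
  go (inj₁ e) = inj₁ e
  go (inj₂ m) = inj₂ (∈-++⁺ˡ m)

incl₁ : ∀ m → Hom ⟨ m ∣ [] ⟩ ⟨ suc m ∣ (map inject₁ (allFin m) , fromℕ m ∷ []) ∷ [] ⟩
incl₁ m = record { fun = inject₁ ; preserves = go }
  where
  go : ∀ {u v} → (u ≡ v) ⊎ ((u , v) ∈ []) → _
  go (inj₁ e) = inj₁ (cong (map inject₁) e)
  go (inj₂ ())

-- The words u, v, w, w' of the generators a_1 … a_N, N = m+n(+p(+q)).
-- Generator a_{i+1} is the element i of Fin N.
u₂ : ∀ m n → List (Fin (m + n))
u₂ m n = map (_↑ˡ n) (allFin m)
v₂ : ∀ m n → List (Fin (m + n))
v₂ m n = map (m ↑ʳ_) (allFin n)

u₃ : ∀ m n p → List (Fin (m + n + p))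
u₃ m n p = map (_↑ˡ p) (u₂ m n)
v₃ : ∀ m n p → List (Fin (m + n + p))
v₃ m n p = map (_↑ˡ p) (v₂ m n)
w₃ : ∀ m n p → List (Fin (m + n + p))
w₃ m n p = map ((m + n) ↑ʳ_) (allFin p)

u₄ : ∀ m n p q → List (Fin (m + n + p + q))
u₄ m n p q = map (_↑ˡ q) (u₃ m n p)
v₄ : ∀ m n p q → List (Fin (m + n + p + q))
v₄ m n p q = map (_↑ˡ q) (v₃ m n p)
w₄ : ∀ m n p q → List (Fin (m + n + p + q))
w₄ m n p q = map (_↑ˡ q) (w₃ m n p)
w'₄ : ∀ m n p q → List (Fin (m + n + p + q))
w'₄ m n p q = map ((m + n + p) ↑ʳ_) (allFin q)

data InJ : ∀ {P Q} → Hom P Q → Set₁ where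
  j₁ : ∀ m → InJ (incl₁ m)
  j₂ : ∀ m → InJ (inclRel m [] ((allFin m , allFin m) ∷ []))
  j₃ : ∀ m n → InJ (inclRel (m + n) ((u₂ m n , v₂ m n) ∷ []) ((v₂ m n , u₂ m n) ∷ []))
  j₄ : ∀ m n p → InJ (inclRel (m + n + p)
          ((u₃ m n p , v₃ m n p) ∷ (v₃ m n p , w₃ m n p) ∷ [])
          ((u₃ m n p , w₃ m n p) ∷ []))
  j₅ : ∀ m n p q → InJ (inclRel (m + n + p + q)
          ((u₄ m n p q , v₄ m n p q) ∷ [])
          ((w₄ m n p q ++ u₄ m n p q ++ w'₄ m n p q , w₄ m n p q ++ v₄ m n p q ++ w'₄ m n p q) ∷ []))

data Cell : ∀ {P Q} → Hom P Q → Set₁ where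
  base : ∀ {P Q} {f : Hom P Q} → InJ f → Cell f
  coprod : ∀ {I : Set} {A B : I → RPres} (f : ∀ i → Hom (A i) (B i)) →
    (∀ i → Cell (f i)) →
    ∀ {SA SB} (ιA : ∀ i → Hom (A i) SA) (ιB : ∀ i → Hom (B i) SB) →
    IsCoproduct A ιA → IsCoproduct B ιB →
    (h : Hom SA SB) → (∀ i → (h ∘H ιA i) ≈H (ιB i ∘H f i)) → Cell h
  pushout : ∀ {A B C D} (f : Hom A B) (g : Hom A C) (f' : Hom C D) (g' : Hom B D) →
    Cell f → IsPushout f g f' g' → Cell f'
  comp : ∀ {A B C} {f : Hom A B} {g : Hom B C} → Cell f → Cell g → Cell (g ∘H f)
  ωcomp : ∀ (X : ℕ → RPres) (s : ∀ n → Hom (X n) (X (suc n))) → (∀ n → Cell (s n)) →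
    ∀ {L} (c : ∀ n → Hom (X n) L) → IsSeqColimit X s c → Cell (c 0)

-- Every map f : P → Q in cell(𝒥) is a Tietze map: there is a substitution s sending each generator of
-- Q to a word over P with s (f a) = a and b ∼ f*(s b), so f* and s induce mutually inverse isomorphisms
-- P̄ ≅ Q̄. The generating inclusions are Tietze maps, and the property passes to coproducts, pushouts and
-- ω-composites because these maps are moreover injective on generators with decidable image, which is
-- what makes the legs of the colimit jointly cover its generators. Conversely, given φ : P̄ ≅ Q̄, let R
-- have generators P₁ ⊔ Q₁, a ∈ P₁ standing for φ(a), and a relation u ⇒ v whenever u and v are equal
-- in Q̄. From P one reaches R by adjoining each b ∈ Q₁ with the defining relation φ⁻¹(b) ⇒ b (a
-- pushout of maps of type (1)) and then closing the relations under symmetry, transitivity and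
-- contexts (an ω-composite of pushouts of maps of types (3)–(5)); from Q one proceeds symmetrically.

module Submission where

open import Algebra.Morphism.Structures using (module MonoidMorphisms)
open import Data.Fin using (Fin; inject₁; fromℕ; _↑ˡ_; _↑ʳ_)
open import Data.Fin.Relation.Unary.Top using (View; view; ‵fromℕ; ‵inj₁; view-inject₁; view-fromℕ)
open import Data.List using (List; []; _∷_; _++_; [_]; map; concat; concatMap; allFin; length; lookup)
open import Data.List.Effectful using (module MonadProperties)
open import Data.List.Membership.Propositional using (_∈_)
open import Data.List.Membership.Propositional.Properties using (∈-++⁻; ∈-++⁺ʳ)
open import Data.List.Properties
  using (++-identityʳ; map-id; map-++; map-∘; map-cong; map-tabulate; tabulate-lookup; concat-map-[_];
         concatMap-map; concatMap-pure; concatMap-++; map-concatMap)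
open import Data.List.Relation.Unary.Any using (here; there)
open import Data.Maybe using (Maybe; just; nothing; maybe′; _>>=_)
import Data.Maybe as Maybe
open import Data.Maybe.Properties using (just-injective)
open import Data.Nat using (ℕ; zero; suc; _+_; _⊔_; _≤′_; ≤′-refl; ≤′-step)
open import Data.Nat.Properties using (≤⇒≤′; m≤m⊔n; m≤n⊔m)
open import Data.Product using (Σ; _×_; _,_; proj₁; proj₂; uncurry)
open import Data.Sum using (_⊎_; inj₁; inj₂; [_,_]′)
open import Data.Sum.Properties using (swap-↔)
open import Data.Vec.Functional using () renaming (_++_ to _++ᵛ_)
open import Data.Vec.Functional.Properties using (lookup-++ˡ; lookup-++ʳ)
open import Function using (_∘_; const)
open import Function.Bundles using (_↔_; module Inverse; _⇔_; mk⇔)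
open import Function.Properties.Inverse using (↔-refl)
open import Relation.Binary.PropositionalEquality
  using (_≡_; refl; sym; trans; cong; cong₂; subst; subst₂; module ≡-Reasoning)

open import Defs

≡⇒∼ : ∀ {P : RPres} {x y} → x ≡ y → Cong P x y
≡⇒∼ refl = ∼refl

++-congˡ : ∀ {P : RPres} w {u v} → Cong P u v → Cong P (w ++ u) (w ++ v)
++-congˡ {P} w {u} {v} c =
  subst₂ (Cong P) (cong (w ++_) (++-identityʳ u)) (cong (w ++_) (++-identityʳ v)) (∼ctx w [] c)

++-cong : ∀ {P : RPres} {u u′ v v′} → Cong P u u′ → Cong P v v′ → Cong P (u ++ v) (u′ ++ v′)
++-cong {v = v} c d = ∼trans (∼ctx [] v c) (++-congˡ _ d)

Cong⁺ : ∀ {P Q : RPres} (F : List (Gn P) → List (Gn Q)) →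
  (∀ x y → F (x ++ y) ≡ F x ++ F y) → (∀ {u v} → Rl P u v → Cong Q (F u) (F v)) →
  ∀ {x y} → Cong P x y → Cong Q (F x) (F y)
Cong⁺ F F-++ F-rel (rel r) = F-rel r
Cong⁺ F F-++ F-rel ∼refl = ∼refl
Cong⁺ F F-++ F-rel (∼sym c) = ∼sym (Cong⁺ F F-++ F-rel c)
Cong⁺ F F-++ F-rel (∼trans c d) = ∼trans (Cong⁺ F F-++ F-rel c) (Cong⁺ F F-++ F-rel d)
Cong⁺ {Q = Q} F F-++ F-rel (∼ctx {u} {v} w w′ c) =
  subst₂ (Cong Q) (sym (F-++₃ u)) (sym (F-++₃ v)) (∼ctx (F w) (F w′) (Cong⁺ F F-++ F-rel c))
  where
  F-++₃ : ∀ u → F (w ++ u ++ w′) ≡ F w ++ F u ++ F w′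
  F-++₃ u = trans (F-++ w (u ++ w′)) (cong (F w ++_) (F-++ u w′))

Cong-map⁺ : ∀ {P Q} (f : Hom P Q) {x y} → Cong P x y → Cong Q (map (fun f) x) (map (fun f) y)
Cong-map⁺ f = Cong⁺ (map (fun f)) (map-++ (fun f)) (rel ∘ preserves f)

W : RPres → RPres
W P = record
  { pres = record { Gen = List (Gn P) ; _⇒_ = λ xs ys → Cong P (concat xs) (concat ys) }
  ; isRefl = λ _ → ∼refl }

Subst : RPres → RPres → Set
Subst Q P = Hom Q (W P)

_⟪_⟫ : ∀ {P Q} → Subst Q P → List (Gn Q) → List (Gn P)
s ⟪ x ⟫ = concatMap (fun s) x

Cong-subst⁺ : ∀ {P Q} (s : Subst Q P) {x y} → Cong Q x y → Cong P (s ⟪ x ⟫) (s ⟪ y ⟫)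
Cong-subst⁺ s = Cong⁺ (s ⟪_⟫) (concatMap-++ (fun s)) (preserves s)

idS : ∀ {P} → Subst P P
idS {P} = record
  { fun = [_]
  ; preserves = λ {u} {v} r → subst₂ (Cong P) (sym (concat-map-[ u ])) (sym (concat-map-[ v ])) (rel r) }

_∘S_ : ∀ {O P Q} → Subst P O → Subst Q P → Subst Q O
_∘S_ {O} τ σ = record
  { fun = λ b → τ ⟪ fun σ b ⟫
  ; preserves = λ {u} {v} r →
      subst₂ (Cong O) (sym (MonadProperties.associative u (fun σ) (fun τ)))
                      (sym (MonadProperties.associative v (fun σ) (fun τ)))
                      (Cong-subst⁺ τ (preserves σ r)) }

_◃S_ : ∀ {P Q R} → Hom P Q → Subst R P → Subst R Q
_◃S_ {Q = Q} f s = record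
  { fun = map (fun f) ∘ fun s
  ; preserves = λ {u} {v} r →
      subst₂ (Cong Q) (map-concatMap (fun f) (fun s) u) (map-concatMap (fun f) (fun s) v)
                      (Cong-map⁺ f (preserves s r)) }

record IsTietze {P Q : RPres} (f : Hom P Q) : Set where
  field
    inverse : Subst Q P
    inverse-fun : ∀ a → fun inverse (fun f a) ≡ [ a ]
    fun-inverse : ∀ b → Cong Q [ b ] (map (fun f) (fun inverse b))

  inverse-map : ∀ x → inverse ⟪ map (fun f) x ⟫ ≡ x
  inverse-map [] = refl
  inverse-map (a ∷ x) = cong₂ _++_ (inverse-fun a) (inverse-map x)

  map-inverse : ∀ w → Cong Q w (map (fun f) (inverse ⟪ w ⟫))
  map-inverse [] = ∼refl
  map-inverse (b ∷ w) = subst (Cong Q (b ∷ w)) (sym (map-++ (fun f) (fun inverse b) (inverse ⟪ w ⟫)))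
                              (++-cong (fun-inverse b) (map-inverse w))

  map-reflects : ∀ {x y} → Cong Q (map (fun f) x) (map (fun f) y) → Cong P x y
  map-reflects {x} {y} c = subst₂ (Cong P) (inverse-map x) (inverse-map y) (Cong-subst⁺ inverse c)

record IsDecidableEmbedding {P Q : RPres} (f : Hom P Q) : Set where
  field
    preimage : Gn Q → Maybe (Gn P)
    preimage-fun : ∀ a → preimage (fun f a) ≡ just a
    preimage-just : ∀ {b a} → preimage b ≡ just a → fun f a ≡ b

tietze-id : ∀ {P} → IsTietze (idH {P})
tietze-id = record { inverse = idS ; inverse-fun = λ _ → refl ; fun-inverse = λ _ → ∼refl }

tietze-∘ : ∀ {A B C} {f : Hom A B} {g : Hom B C} → IsTietze f → IsTietze g → IsTietze (g ∘H f)
tietze-∘ {C = C} {f} {g} F G = record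
  { inverse = F.inverse ∘S G.inverse
  ; inverse-fun = inverse-fun
  ; fun-inverse = λ c → ∼trans (G.fun-inverse c)
      (subst (Cong C _) (sym (map-∘ _)) (Cong-map⁺ g (F.map-inverse (fun G.inverse c)))) }
  where
  module F = IsTietze F
  module G = IsTietze G
  open ≡-Reasoning
  inverse-fun : ∀ a → F.inverse ⟪ fun G.inverse (fun g (fun f a)) ⟫ ≡ [ a ]
  inverse-fun a = begin
    F.inverse ⟪ fun G.inverse (fun g (fun f a)) ⟫ ≡⟨ cong (F.inverse ⟪_⟫) (G.inverse-fun (fun f a)) ⟩
    fun F.inverse (fun f a) ++ []                 ≡⟨ ++-identityʳ _ ⟩
    fun F.inverse (fun f a)                       ≡⟨ F.inverse-fun a ⟩
    [ a ]                                         ∎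

embedding-id : ∀ {P} → IsDecidableEmbedding (idH {P})
embedding-id = record
  { preimage = just ; preimage-fun = λ _ → refl ; preimage-just = sym ∘ just-injective }

embedding-∘ : ∀ {A B C} {f : Hom A B} {g : Hom B C} →
  IsDecidableEmbedding f → IsDecidableEmbedding g → IsDecidableEmbedding (g ∘H f)
embedding-∘ {A} {B} {C} {f} {g} F G = record
  { preimage = preimage ; preimage-fun = preimage-fun ; preimage-just = preimage-just }
  where
  module F = IsDecidableEmbedding F
  module G = IsDecidableEmbedding G
  preimage : Gn C → Maybe (Gn A)
  preimage c = G.preimage c >>= F.preimage
  preimage-fun : ∀ a → preimage (fun g (fun f a)) ≡ just a
  preimage-fun a rewrite G.preimage-fun (fun f a) = F.preimage-fun a
  preimage-just : ∀ {c a} → preimage c ≡ just a → fun g (fun f a) ≡ c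
  preimage-just {c} eq with G.preimage c in eqG
  ... | just b = trans (cong (fun g) (F.preimage-just eq)) (G.preimage-just eqG)

lowerView : ∀ {n} {i : Fin (suc n)} → View i → Maybe (Fin n)
lowerView ‵fromℕ = nothing
lowerView (‵inj₁ {i = j} _) = just j

lower? : ∀ {n} → Fin (suc n) → Maybe (Fin n)
lower? i = lowerView (view i)

lower?-inject₁ : ∀ {n} (j : Fin n) → lower? (inject₁ j) ≡ just j
lower?-inject₁ j rewrite view-inject₁ j = refl

lower?-fromℕ : ∀ n → lower? (fromℕ n) ≡ nothing
lower?-fromℕ n rewrite view-fromℕ n = refl

lower?-just : ∀ {n} (i : Fin (suc n)) {j} → lower? i ≡ just j → inject₁ j ≡ i
lower?-just i eq with view i
... | ‵inj₁ {i = k} _ = cong inject₁ (just-injective (sym eq))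

lower?-nothing : ∀ {n} (i : Fin (suc n)) → lower? i ≡ nothing → fromℕ n ≡ i
lower?-nothing i eq with view i
... | ‵fromℕ = refl

tietze-inclRel : ∀ k (rs extra : List (List (Fin k) × List (Fin k))) →
  (∀ {u v} → (u , v) ∈ extra → Cong ⟨ k ∣ rs ⟩ u v) → IsTietze (inclRel k rs extra)
tietze-inclRel k rs extra derivable = record
  { inverse = record { fun = [_] ; preserves = preserves′ }
  ; inverse-fun = λ _ → refl
  ; fun-inverse = λ _ → ∼refl }
  where
  derive : ∀ {u v} → (u ≡ v) ⊎ ((u , v) ∈ rs ++ extra) → Cong ⟨ k ∣ rs ⟩ u v
  derive (inj₁ u≡v) = ≡⇒∼ u≡v
  derive (inj₂ r) with ∈-++⁻ rs r
  ... | inj₁ r∈rs = rel (inj₂ r∈rs)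
  ... | inj₂ r∈extra = derivable r∈extra
  preserves′ : ∀ {u v} → (u ≡ v) ⊎ ((u , v) ∈ rs ++ extra) → Cong ⟨ k ∣ rs ⟩ (concatMap [_] u) (concatMap [_] v)
  preserves′ {u} {v} r = subst₂ (Cong ⟨ k ∣ rs ⟩) (sym (concatMap-pure u)) (sym (concatMap-pure v)) (derive r)

embedding-inclRel : ∀ k (rs extra : List (List (Fin k) × List (Fin k))) →
  IsDecidableEmbedding (inclRel k rs extra)
embedding-inclRel k rs extra = record
  { preimage = just ; preimage-fun = λ _ → refl ; preimage-just = sym ∘ just-injective }

tietze-incl₁ : ∀ m → IsTietze (incl₁ m)
tietze-incl₁ m = record
  { inverse = record { fun = expand ; preserves = preserves′ }
  ; inverse-fun = expand-inject₁
  ; fun-inverse = fun-expand }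
  where
  Q = ⟨ suc m ∣ (map inject₁ (allFin m) , fromℕ m ∷ []) ∷ [] ⟩
  expand : Fin (suc m) → List (Fin m)
  expand b = maybe′ [_] (allFin m) (lower? b)
  expand-inject₁ : ∀ a → expand (inject₁ a) ≡ [ a ]
  expand-inject₁ a rewrite lower?-inject₁ a = refl
  open ≡-Reasoning
  expand-relation : concatMap expand (map inject₁ (allFin m)) ≡ concatMap expand [ fromℕ m ]
  expand-relation = begin
    concatMap expand (map inject₁ (allFin m)) ≡⟨ concatMap-map expand inject₁ (allFin m) ⟩
    concatMap (expand ∘ inject₁) (allFin m)   ≡⟨ cong concat (map-cong expand-inject₁ (allFin m)) ⟩
    concatMap [_] (allFin m)                  ≡⟨ concatMap-pure (allFin m) ⟩
    allFin m                                  ≡⟨ cong (maybe′ [_] (allFin m)) (lower?-fromℕ m) ⟨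
    expand (fromℕ m)                          ≡⟨ ++-identityʳ _ ⟨
    concatMap expand [ fromℕ m ]              ∎
  preserves′ : ∀ {u v} → Rl Q u v → Cong ⟨ m ∣ [] ⟩ (concatMap expand u) (concatMap expand v)
  preserves′ (inj₁ refl) = ∼refl
  preserves′ (inj₂ (here refl)) = ≡⇒∼ expand-relation
  fun-expand : ∀ b → Cong Q [ b ] (map inject₁ (expand b))
  fun-expand b with lower? b in eq
  ... | just a = ≡⇒∼ (cong [_] (sym (lower?-just b eq)))
  ... | nothing rewrite sym (lower?-nothing b eq) = ∼sym (rel (inj₂ (here refl)))

embedding-incl₁ : ∀ m → IsDecidableEmbedding (incl₁ m)
embedding-incl₁ m = record
  { preimage = lower? ; preimage-fun = lower?-inject₁ ; preimage-just = lower?-just _ }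

-- Colimits are only known through their universal property. To see that the legs cover the generators,
-- map the colimit into the presentation induced on the disjoint union of the sources; that cocone
-- commutes only if each generator is sent to a canonical source, which is what `preimage` decides.
Induced : ∀ {G : Set} (D : RPres) → (G → Gn D) → RPres
Induced {G} D v = record
  { pres = record { Gen = G ; _⇒_ = λ x y → Rl D (map v x) (map v y) }
  ; isRefl = λ u → isRefl D (map v u) }

induced-π : ∀ {G D} (v : G → Gn D) → Hom (Induced D v) D
induced-π v = record { fun = v ; preserves = λ r → r }

induced-lift : ∀ {A G D} (v : G → Gn D) (t : Hom A D) (h : Gn A → G) →
  (∀ a → v (h a) ≡ fun t a) → Hom A (Induced D v)
induced-lift {D = D} v t h vh≗t = record
  { fun = h
  ; preserves = λ {x} {y} r → subst₂ (Rl D) (e x) (e y) (preserves t r) }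
  where
  e : ∀ x → map (fun t) x ≡ map v (map h x)
  e x = trans (sym (map-cong vh≗t x)) (map-∘ x)

pushout-cover : ∀ {A B C D} (f : Hom A B) (g : Hom A C) (f′ : Hom C D) (g′ : Hom B D) →
  IsDecidableEmbedding f → IsPushout f g f′ g′ →
  Σ (Gn D → Gn C ⊎ Gn B) λ e → (∀ d → [ fun f′ , fun g′ ]′ (e d) ≡ d) × (∀ c → e (fun f′ c) ≡ inj₁ c)
pushout-cover {A} {B} {C} {D} f g f′ g′ F (commutes , universal) =
  fun u , u-section , u∘f′
  where
  module F = IsDecidableEmbedding F
  v : Gn C ⊎ Gn B → Gn D
  v = [ fun f′ , fun g′ ]′
  classify : Gn B → Gn C ⊎ Gn B
  classify b = maybe′ (inj₁ ∘ fun g) (inj₂ b) (F.preimage b)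
  v-classify : ∀ b → v (classify b) ≡ fun g′ b
  v-classify b with F.preimage b in eq
  ... | just a = trans (sym (commutes a)) (cong (fun g′) (F.preimage-just eq))
  ... | nothing = refl
  lift-B = induced-lift v g′ classify v-classify
  lift-C = induced-lift v f′ inj₁ (λ _ → refl)
  compatible : (lift-B ∘H f) ≈H (lift-C ∘H g)
  compatible a rewrite F.preimage-fun a = refl
  U = universal (Induced D v) lift-B lift-C compatible
  u = proj₁ U
  u∘f′ : ∀ c → fun u (fun f′ c) ≡ inj₁ c
  u∘f′ = proj₁ (proj₂ (proj₂ U))
  u-section : ∀ d → v (fun u d) ≡ d
  u-section d = trans (unique (induced-π v ∘H u) (λ b → trans (cong v (proj₁ (proj₂ U) b)) (v-classify b))
                                                 (λ c → cong v (u∘f′ c)) d)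
                      (sym (unique idH (λ _ → refl) (λ _ → refl) d))
    where unique = proj₂ (proj₂ (proj₂ (universal D g′ f′ commutes)))

embedding-via-cover : ∀ {P Q} (f : Hom P Q) {T : Set} (v : T → Gn Q) (e : Gn Q → T) →
  (∀ b → v (e b) ≡ b) → (π : T → Maybe (Gn P)) →
  (∀ t {a} → π t ≡ just a → fun f a ≡ v t) → (∀ a → π (e (fun f a)) ≡ just a) →
  IsDecidableEmbedding f
embedding-via-cover f v e v∘e π π-sound π-fun = record
  { preimage = π ∘ e
  ; preimage-fun = π-fun
  ; preimage-just = λ {b} eq → trans (π-sound (e b) eq) (v∘e b) }

tietze-via-cover : ∀ {P Q} (f : Hom P Q) (inverse : Subst Q P) →
  (∀ a → fun inverse (fun f a) ≡ [ a ]) → {T : Set} (v : T → Gn Q) (e : Gn Q → T) →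
  (∀ b → v (e b) ≡ b) → (∀ t → Cong Q [ v t ] (map (fun f) (fun inverse (v t)))) →
  IsTietze f
tietze-via-cover {Q = Q} f inverse inverse-fun v e v∘e cover = record
  { inverse = inverse
  ; inverse-fun = inverse-fun
  ; fun-inverse = λ b → subst (λ z → Cong Q [ z ] (map (fun f) (fun inverse z))) (v∘e b) (cover (e b)) }

embedding-pushout : ∀ {A B C D} (f : Hom A B) (g : Hom A C) (f′ : Hom C D) (g′ : Hom B D) →
  IsDecidableEmbedding f → IsPushout f g f′ g′ → IsDecidableEmbedding f′
embedding-pushout f g f′ g′ F po =
  embedding-via-cover f′ [ fun f′ , fun g′ ]′ e e-section [ just , const nothing ]′ π-sound
    (λ c → cong [ just , const nothing ]′ (e∘f′ c))
  where
  cover = pushout-cover f g f′ g′ F po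
  e = proj₁ cover
  e-section = proj₁ (proj₂ cover)
  e∘f′ = proj₂ (proj₂ cover)
  π-sound : ∀ t {c} → [ just , const nothing ]′ t ≡ just c → fun f′ c ≡ [ fun f′ , fun g′ ]′ t
  π-sound (inj₁ c) eq = cong (fun f′) (just-injective (sym eq))

tietze-pushout : ∀ {A B C D} (f : Hom A B) (g : Hom A C) (f′ : Hom C D) (g′ : Hom B D) →
  IsDecidableEmbedding f → IsTietze f → IsPushout f g f′ g′ → IsTietze f′
tietze-pushout {A} {B} {C} {D} f g f′ g′ E F po@(commutes , universal) =
  tietze-via-cover f′ inverse inverse∘f′ [ fun f′ , fun g′ ]′ (proj₁ cover) (proj₁ (proj₂ cover)) covers
  where
  module F = IsTietze F
  cover = pushout-cover f g f′ g′ E po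
  S = universal (W C) (g ◃S F.inverse) idS (λ a → cong (map (fun g)) (F.inverse-fun a))
  inverse = proj₁ S
  inverse∘g′ : ∀ b → fun inverse (fun g′ b) ≡ map (fun g) (fun F.inverse b)
  inverse∘g′ = proj₁ (proj₂ S)
  inverse∘f′ : ∀ c → fun inverse (fun f′ c) ≡ [ c ]
  inverse∘f′ = proj₁ (proj₂ (proj₂ S))
  open ≡-Reasoning
  square : ∀ b → map (fun g′) (map (fun f) (fun F.inverse b)) ≡ map (fun f′) (fun inverse (fun g′ b))
  square b = begin
    map (fun g′) (map (fun f) (fun F.inverse b)) ≡⟨ map-∘ _ ⟨
    map (fun g′ ∘ fun f) (fun F.inverse b)       ≡⟨ map-cong commutes _ ⟩
    map (fun f′ ∘ fun g) (fun F.inverse b)       ≡⟨ map-∘ _ ⟩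
    map (fun f′) (map (fun g) (fun F.inverse b)) ≡⟨ cong (map (fun f′)) (inverse∘g′ b) ⟨
    map (fun f′) (fun inverse (fun g′ b))        ∎
  covers : ∀ t → Cong D [ [ fun f′ , fun g′ ]′ t ] (map (fun f′) (fun inverse ([ fun f′ , fun g′ ]′ t)))
  covers (inj₁ c) = ≡⇒∼ (cong (map (fun f′)) (sym (inverse∘f′ c)))
  covers (inj₂ b) = subst (Cong D [ fun g′ b ]) (square b) (Cong-map⁺ g′ (F.fun-inverse b))

coproduct-cover : ∀ {I : Set} (X : I → RPres) {S} (ι : ∀ i → Hom (X i) S) → IsCoproduct X ι →
  Σ (Gn S → Σ I (λ i → Gn (X i))) λ e →
    (∀ s → uncurry (λ i → fun (ι i)) (e s) ≡ s) × (∀ i a → e (fun (ι i) a) ≡ (i , a))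
coproduct-cover {I} X {S} ι universal = fun u , u-section , u∘ι
  where
  v : Σ I (λ i → Gn (X i)) → Gn S
  v = uncurry (λ i → fun (ι i))
  U = universal (Induced S v) (λ i → induced-lift v (ι i) (i ,_) (λ _ → refl))
  u = proj₁ U
  u∘ι = proj₁ (proj₂ U)
  u-section : ∀ s → v (fun u s) ≡ s
  u-section s = trans (unique (induced-π v ∘H u) (λ i a → cong v (u∘ι i a)) s)
                      (sym (unique idH (λ _ _ → refl) s))
    where unique = proj₂ (proj₂ (universal S ι))

coproduct-elim : ∀ {I : Set} (X : I → RPres) {S} (ι : ∀ i → Hom (X i) S) → IsCoproduct X ι →
  (Q : Gn S → Set) → (∀ i a → Q (fun (ι i) a)) → ∀ s → Q s
coproduct-elim X ι universal Q Qι s with coproduct-cover X ι universal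
... | e , e-section , _ = subst Q (e-section s) (Qι (proj₁ (e s)) (proj₂ (e s)))

module _ {I : Set} {A B : I → RPres} (f : ∀ i → Hom (A i) (B i))
         {SA SB} (ιA : ∀ i → Hom (A i) SA) (ιB : ∀ i → Hom (B i) SB)
         (coprodA : IsCoproduct A ιA) (coprodB : IsCoproduct B ιB)
         (h : Hom SA SB) (h∘ιA : ∀ i → (h ∘H ιA i) ≈H (ιB i ∘H f i)) where

  private
    coverB = coproduct-cover B ιB coprodB
    e = proj₁ coverB
    e-section = proj₁ (proj₂ coverB)
    e∘ιB = proj₂ (proj₂ coverB)

  embedding-coproduct : (∀ i → IsDecidableEmbedding (f i)) → IsDecidableEmbedding h
  embedding-coproduct F =
    embedding-via-cover h (uncurry (λ i → fun (ιB i))) e e-section π π-sound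
      (coproduct-elim A ιA coprodA (λ x → π (e (fun h x)) ≡ just x) π-fun-ι)
    where
    module F i = IsDecidableEmbedding (F i)
    π : Σ I (λ i → Gn (B i)) → Maybe (Gn SA)
    π (i , b) = Maybe.map (fun (ιA i)) (F.preimage i b)
    π-sound : ∀ t {x} → π t ≡ just x → fun h x ≡ uncurry (λ i → fun (ιB i)) t
    π-sound (i , b) eq with F.preimage i b in eqF
    ... | just a rewrite sym (just-injective eq) = trans (h∘ιA i a) (cong (fun (ιB i)) (F.preimage-just i eqF))
    π-fun-ι : ∀ i a → π (e (fun h (fun (ιA i) a))) ≡ just (fun (ιA i) a)
    π-fun-ι i a rewrite h∘ιA i a | e∘ιB i (fun (f i) a) | F.preimage-fun i a = refl

  tietze-coproduct : (∀ i → IsTietze (f i)) → IsTietze h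
  tietze-coproduct F =
    tietze-via-cover h inverse (coproduct-elim A ιA coprodA (λ x → fun inverse (fun h x) ≡ [ x ]) inverse-fun-ι)
      (uncurry (λ i → fun (ιB i))) e e-section covers
    where
    module F i = IsTietze (F i)
    S = coprodB (W SA) (λ i → ιA i ◃S F.inverse i)
    inverse = proj₁ S
    inverse∘ιB : ∀ i b → fun inverse (fun (ιB i) b) ≡ map (fun (ιA i)) (fun (F.inverse i) b)
    inverse∘ιB = proj₁ (proj₂ S)
    inverse-fun-ι : ∀ i a → fun inverse (fun h (fun (ιA i) a)) ≡ [ fun (ιA i) a ]
    inverse-fun-ι i a rewrite h∘ιA i a | inverse∘ιB i (fun (f i) a) | F.inverse-fun i a = refl
    open ≡-Reasoning
    square : ∀ i b → map (fun (ιB i)) (map (fun (f i)) (fun (F.inverse i) b)) ≡ map (fun h) (fun inverse (fun (ιB i) b))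
    square i b = begin
      map (fun (ιB i)) (map (fun (f i)) (fun (F.inverse i) b)) ≡⟨ map-∘ _ ⟨
      map (fun (ιB i) ∘ fun (f i)) (fun (F.inverse i) b)       ≡⟨ map-cong (h∘ιA i) _ ⟨
      map (fun h ∘ fun (ιA i)) (fun (F.inverse i) b)           ≡⟨ map-∘ _ ⟩
      map (fun h) (map (fun (ιA i)) (fun (F.inverse i) b))     ≡⟨ cong (map (fun h)) (inverse∘ιB i b) ⟨
      map (fun h) (fun inverse (fun (ιB i) b))                 ∎
    covers : ∀ t → Cong SB [ uncurry (λ i → fun (ιB i)) t ] (map (fun h) (fun inverse (uncurry (λ i → fun (ιB i)) t)))
    covers (i , b) = subst (Cong SB [ fun (ιB i) b ]) (square i b) (Cong-map⁺ (ιB i) (F.fun-inverse i b))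

chain : ∀ {X : ℕ → RPres} (s : ∀ n → Hom (X n) (X (suc n))) → ∀ m → Hom (X 0) (X m)
chain s zero = idH
chain s (suc m) = s m ∘H chain s m

module _ (X : ℕ → RPres) (s : ∀ n → Hom (X n) (X (suc n)))
         {L} (c : ∀ n → Hom (X n) L) (colimit : IsSeqColimit X s c) where

  private
    commutes = proj₁ colimit
    universal = proj₂ colimit

  cocone-chain : ∀ m a → fun (c m) (fun (chain s m) a) ≡ fun (c 0) a
  cocone-chain zero a = refl
  cocone-chain (suc m) a = trans (commutes m (fun (chain s m) a)) (cocone-chain m a)

  seqColimit-cover : (∀ n → IsDecidableEmbedding (s n)) →
    Σ (Gn L → Σ ℕ (λ n → Gn (X n))) λ e →
      (∀ l → uncurry (λ n → fun (c n)) (e l) ≡ l) × (∀ a → e (fun (c 0) a) ≡ (0 , a))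
  seqColimit-cover E = fun u , u-section , proj₁ (proj₂ U) 0
    where
    module E n = IsDecidableEmbedding (E n)
    v : Σ ℕ (λ n → Gn (X n)) → Gn L
    v = uncurry (λ n → fun (c n))
    earliest : ∀ n → Gn (X n) → Σ ℕ (λ n → Gn (X n))
    earliest zero x = 0 , x
    earliest (suc n) y = maybe′ (earliest n) (suc n , y) (E.preimage n y)
    v-earliest : ∀ n x → v (earliest n x) ≡ fun (c n) x
    v-earliest zero x = refl
    v-earliest (suc n) y with E.preimage n y in eq
    ... | just x = trans (v-earliest n x) (trans (sym (commutes n x)) (cong (fun (c (suc n))) (E.preimage-just n eq)))
    ... | nothing = refl
    lift : ∀ n → Hom (X n) (Induced L v)
    lift n = induced-lift v (c n) (earliest n) (v-earliest n)
    compatible : ∀ n → (lift (suc n) ∘H s n) ≈H lift n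
    compatible n x rewrite E.preimage-fun n x = refl
    U = universal (Induced L v) lift compatible
    u = proj₁ U
    u-section : ∀ l → v (fun u l) ≡ l
    u-section l = trans (unique (induced-π v ∘H u) (λ n x → trans (cong v (proj₁ (proj₂ U) n x)) (v-earliest n x)) l)
                        (sym (unique idH (λ _ _ → refl) l))
      where unique = proj₂ (proj₂ (universal L c commutes))

  embedding-seqColimit : (∀ n → IsDecidableEmbedding (s n)) → IsDecidableEmbedding (c 0)
  embedding-seqColimit E =
    embedding-via-cover (c 0) (uncurry (λ n → fun (c n))) e e-section π π-sound (λ a → cong π (e∘c₀ a))
    where
    cover = seqColimit-cover E
    e = proj₁ cover
    e-section = proj₁ (proj₂ cover)
    e∘c₀ = proj₂ (proj₂ cover)
    embedding-chain : ∀ m → IsDecidableEmbedding (chain s m)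
    embedding-chain zero = embedding-id
    embedding-chain (suc m) = embedding-∘ (embedding-chain m) (E m)
    π : Σ ℕ (λ n → Gn (X n)) → Maybe (Gn (X 0))
    π (m , y) = IsDecidableEmbedding.preimage (embedding-chain m) y
    π-sound : ∀ t {a} → π t ≡ just a → fun (c 0) a ≡ uncurry (λ n → fun (c n)) t
    π-sound (m , y) eq =
      trans (sym (cocone-chain m _)) (cong (fun (c m)) (IsDecidableEmbedding.preimage-just (embedding-chain m) eq))

  tietze-seqColimit : (∀ n → IsDecidableEmbedding (s n)) → (∀ n → IsTietze (s n)) → IsTietze (c 0)
  tietze-seqColimit E T =
    tietze-via-cover (c 0) inverse (inverse∘c 0) (uncurry (λ n → fun (c n)))
      (proj₁ cover) (proj₁ (proj₂ cover)) covers
    where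
    cover = seqColimit-cover E
    tietze-chain : ∀ m → IsTietze (chain s m)
    tietze-chain zero = tietze-id
    tietze-chain (suc m) = tietze-∘ (tietze-chain m) (T m)
    module T m = IsTietze (tietze-chain m)
    compatible : ∀ n → (T.inverse (suc n) ∘H s n) ≈H T.inverse n
    compatible n x = trans (cong (T.inverse n ⟪_⟫) (IsTietze.inverse-fun (T n) x)) (++-identityʳ _)
    S = universal (W (X 0)) T.inverse compatible
    inverse = proj₁ S
    inverse∘c : ∀ n y → fun inverse (fun (c n) y) ≡ fun (T.inverse n) y
    inverse∘c = proj₁ (proj₂ S)
    open ≡-Reasoning
    square : ∀ m y → map (fun (c m)) (map (fun (chain s m)) (fun (T.inverse m) y)) ≡ map (fun (c 0)) (fun inverse (fun (c m) y))
    square m y = begin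
      map (fun (c m)) (map (fun (chain s m)) (fun (T.inverse m) y)) ≡⟨ map-∘ _ ⟨
      map (fun (c m) ∘ fun (chain s m)) (fun (T.inverse m) y)       ≡⟨ map-cong (cocone-chain m) _ ⟩
      map (fun (c 0)) (fun (T.inverse m) y)                         ≡⟨ cong (map (fun (c 0))) (inverse∘c m y) ⟨
      map (fun (c 0)) (fun inverse (fun (c m) y))                   ∎
    covers : ∀ t → Cong L [ uncurry (λ n → fun (c n)) t ] (map (fun (c 0)) (fun inverse (uncurry (λ n → fun (c n)) t)))
    covers (m , y) = subst (Cong L [ fun (c m) y ]) (square m y) (Cong-map⁺ (c m) (T.fun-inverse m y))

embedding-J : ∀ {P Q} {f : Hom P Q} → InJ f → IsDecidableEmbedding f
embedding-J (j₁ m) = embedding-incl₁ m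
embedding-J (j₂ m) = embedding-inclRel _ _ _
embedding-J (j₃ m n) = embedding-inclRel _ _ _
embedding-J (j₄ m n p) = embedding-inclRel _ _ _
embedding-J (j₅ m n p q) = embedding-inclRel _ _ _

tietze-J : ∀ {P Q} {f : Hom P Q} → InJ f → IsTietze f
tietze-J (j₁ m) = tietze-incl₁ m
tietze-J (j₂ m) = tietze-inclRel _ _ _ λ { (here refl) → ∼refl }
tietze-J (j₃ m n) = tietze-inclRel _ _ _ λ { (here refl) → ∼sym (rel (inj₂ (here refl))) }
tietze-J (j₄ m n p) = tietze-inclRel _ _ _
  λ { (here refl) → ∼trans (rel (inj₂ (here refl))) (rel (inj₂ (there (here refl)))) }
tietze-J (j₅ m n p q) = tietze-inclRel _ _ _
  λ { (here refl) → ∼ctx (w₄ m n p q) (w'₄ m n p q) (rel (inj₂ (here refl))) }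

Cell⇒embedding : ∀ {P Q} {f : Hom P Q} → Cell f → IsDecidableEmbedding f
Cell⇒embedding (base j) = embedding-J j
Cell⇒embedding (coprod f cells ιA ιB cA cB h h∘ιA) =
  embedding-coproduct f ιA ιB cA cB h h∘ιA (Cell⇒embedding ∘ cells)
Cell⇒embedding (pushout f g f′ g′ cell po) = embedding-pushout f g f′ g′ (Cell⇒embedding cell) po
Cell⇒embedding (comp cell₁ cell₂) = embedding-∘ (Cell⇒embedding cell₁) (Cell⇒embedding cell₂)
Cell⇒embedding (ωcomp X s cells c colimit) = embedding-seqColimit X s c colimit (Cell⇒embedding ∘ cells)

Cell⇒tietze : ∀ {P Q} {f : Hom P Q} → Cell f → IsTietze f
Cell⇒tietze (base j) = tietze-J j
Cell⇒tietze (coprod f cells ιA ιB cA cB h h∘ιA) =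
  tietze-coproduct f ιA ιB cA cB h h∘ιA (Cell⇒tietze ∘ cells)
Cell⇒tietze (pushout f g f′ g′ cell po) = tietze-pushout f g f′ g′ (Cell⇒embedding cell) (Cell⇒tietze cell) po
Cell⇒tietze (comp cell₁ cell₂) = tietze-∘ (Cell⇒tietze cell₁) (Cell⇒tietze cell₂)
Cell⇒tietze (ωcomp X s cells c colimit) =
  tietze-seqColimit X s c colimit (Cell⇒embedding ∘ cells) (Cell⇒tietze ∘ cells)

tietze-cospan⇒iso : ∀ {P Q R} {f : Hom P R} {g : Hom Q R} → IsTietze f → IsTietze g → MonoidIso P Q
tietze-cospan⇒iso {P} {Q} {R} {f} {g} F G = φ , record
  { isMonoidMonomorphism = record
    { isMonoidHomomorphism = record
      { isMagmaHomomorphism = record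
        { isRelHomomorphism = record { cong = Cong-subst⁺ G.inverse ∘ Cong-map⁺ f }
        ; homo = λ x y → ≡⇒∼ (φ-++ x y) }
      ; ε-homo = ∼refl }
    ; injective = injective }
  ; surjective = λ y → F.inverse ⟪ map (fun g) y ⟫ , λ z∼ → ∼trans (Cong-subst⁺ G.inverse (Cong-map⁺ f z∼)) (φ-section y) }
  where
  module F = IsTietze F
  module G = IsTietze G
  φ : List (Gn P) → List (Gn Q)
  φ x = G.inverse ⟪ map (fun f) x ⟫
  φ-++ : ∀ x y → φ (x ++ y) ≡ φ x ++ φ y
  φ-++ x y = trans (cong (G.inverse ⟪_⟫) (map-++ (fun f) x y)) (concatMap-++ (fun G.inverse) (map (fun f) x) _)
  injective : ∀ {x y} → Cong Q (φ x) (φ y) → Cong P x y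
  injective {x} {y} φx∼φy = F.map-reflects
    (∼trans (G.map-inverse (map (fun f) x)) (∼trans (Cong-map⁺ g φx∼φy) (∼sym (G.map-inverse (map (fun f) y)))))
  φ-section : ∀ y → Cong Q (φ (F.inverse ⟪ map (fun g) y ⟫)) y
  φ-section y = subst (Cong Q _) (G.inverse-map y)
    (Cong-subst⁺ G.inverse (∼sym (F.map-inverse (map (fun g) y))))

mkRPres : (G : Set) (R : List G → List G → Set) → (∀ u → R u u) → RPres
mkRPres G R R-refl = record { pres = record { Gen = G ; _⇒_ = R } ; isRefl = R-refl }

module Coproduct {I : Set} (X : I → RPres) where

  data CoprodRel : List (Σ I (λ i → Gn (X i))) → List (Σ I (λ i → Gn (X i))) → Set where
    reflexive : ∀ {x} → CoprodRel x x
    summand : ∀ i {x y} → Rl (X i) x y → CoprodRel (map (i ,_) x) (map (i ,_) y)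

  ∐ : RPres
  ∐ = mkRPres (Σ I (λ i → Gn (X i))) CoprodRel (λ _ → reflexive)

  ι : ∀ i → Hom (X i) ∐
  ι i = record { fun = i ,_ ; preserves = summand i }

  copair : ∀ {E} → (∀ i → Hom (X i) E) → Hom ∐ E
  copair {E} k = record { fun = uncurry (λ i → fun (k i)) ; preserves = preserves′ }
    where
    preserves′ : ∀ {x y} → CoprodRel x y → Rl E (map (uncurry (λ i → fun (k i))) x) (map (uncurry (λ i → fun (k i))) y)
    preserves′ {x} reflexive = isRefl E _
    preserves′ (summand i {x} {y} r) = subst₂ (Rl E) (map-∘ x) (map-∘ y) (preserves (k i) r)

  isCoproduct : IsCoproduct X ι
  isCoproduct E k = copair k , (λ i a → refl) , (λ u′ u′∘ι≈k (i , a) → u′∘ι≈k i a)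

map-lookup-allFin : ∀ {A : Set} (xs : List A) → map (lookup xs) (allFin (length xs)) ≡ xs
map-lookup-allFin xs = trans (map-tabulate (λ i → i) (lookup xs)) (tabulate-lookup xs)

freeHom : ∀ {m} {C : RPres} → (Fin m → Gn C) → Hom ⟨ m ∣ [] ⟩ C
freeHom {m} {C} g = record { fun = g ; preserves = λ { (inj₁ refl) → isRefl C _ } }

-- The new generator set is only known up to a bijection with C₁ ⊎ I, so that P and Q can both be
-- extended to the same generator set P₁ ⊎ Q₁.
module AddGenerators (C : RPres) {I : Set} (word : I → List (Gn C)) {G : Set} (tag : (Gn C ⊎ I) ↔ G) where

  open Inverse tag using (to; from; strictlyInverseˡ; strictlyInverseʳ)

  old : Gn C → G
  old = to ∘ inj₁

  new : I → G
  new = to ∘ inj₂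

  data ExtRel : List G → List G → Set where
    reflexive : ∀ {x} → ExtRel x x
    inherited : ∀ {x y} → Rl C x y → ExtRel (map old x) (map old y)
    defining : ∀ i → ExtRel (map old (word i)) [ new i ]

  D : RPres
  D = mkRPres G ExtRel (λ _ → reflexive)

  extend : Hom C D
  extend = record { fun = old ; preserves = inherited }

  private
    arity : I → ℕ
    arity i = length (word i)
    A B : I → RPres
    A i = ⟨ arity i ∣ [] ⟩
    B i = ⟨ suc (arity i) ∣ (map inject₁ (allFin (arity i)) , fromℕ (arity i) ∷ []) ∷ [] ⟩
    module CA = Coproduct A
    module CB = Coproduct B

    h : Hom CA.∐ CB.∐
    h = CA.copair (λ i → CB.ι i ∘H incl₁ (arity i))

    spell : Hom CA.∐ C
    spell = CA.copair (λ i → freeHom (lookup (word i)))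

    name : ∀ i → Fin (suc (arity i)) → G
    name i y = maybe′ (old ∘ lookup (word i)) (new i) (lower? y)

    name-inject₁ : ∀ i a → name i (inject₁ a) ≡ old (lookup (word i) a)
    name-inject₁ i a rewrite lower?-inject₁ a = refl

    name-fromℕ : ∀ i → name i (fromℕ (arity i)) ≡ new i
    name-fromℕ i rewrite lower?-fromℕ (arity i) = refl

    map-name-word : ∀ i → map (name i) (map inject₁ (allFin (arity i))) ≡ map old (word i)
    map-name-word i = begin
      map (name i) (map inject₁ (allFin (arity i)))      ≡⟨ map-∘ _ ⟨
      map (name i ∘ inject₁) (allFin (arity i))          ≡⟨ map-cong (name-inject₁ i) _ ⟩
      map (old ∘ lookup (word i)) (allFin (arity i))     ≡⟨ map-∘ _ ⟩
      map old (map (lookup (word i)) (allFin (arity i))) ≡⟨ cong (map old) (map-lookup-allFin (word i)) ⟩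
      map old (word i)                                   ∎
      where open ≡-Reasoning

    nameHom : ∀ i → Hom (B i) D
    nameHom i = record { fun = name i ; preserves = preserves′ }
      where
      preserves′ : ∀ {u v} → Rl (B i) u v → ExtRel (map (name i) u) (map (name i) v)
      preserves′ (inj₁ refl) = reflexive
      preserves′ (inj₂ (here refl)) =
        subst₂ ExtRel (sym (map-name-word i)) (cong [_] (sym (name-fromℕ i))) (defining i)

    g′ : Hom CB.∐ D
    g′ = CB.copair nameHom

    isPushout : IsPushout h spell extend g′
    isPushout = (λ { (i , a) → name-inject₁ i a }) , universal
      where
      universal : ∀ E (k : Hom CB.∐ E) (l : Hom C E) → (k ∘H h) ≈H (l ∘H spell) →
        Σ (Hom D E) λ u → ((u ∘H g′) ≈H k) × ((u ∘H extend) ≈H l) ×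
          (∀ u′ → (u′ ∘H g′) ≈H k → (u′ ∘H extend) ≈H l → u′ ≈H u)
      universal E k l k∘h≈l∘spell = record { fun = u ; preserves = preserves′ } , u∘g′ , u∘old , unique
        where
        u₀ : Gn C ⊎ I → Gn E
        u₀ = [ fun l , (λ i → fun k (i , fromℕ (arity i))) ]′
        u : G → Gn E
        u = u₀ ∘ from
        u∘old : ∀ c → u (old c) ≡ fun l c
        u∘old c = cong u₀ (strictlyInverseʳ (inj₁ c))
        u∘new : ∀ i → u (new i) ≡ fun k (i , fromℕ (arity i))
        u∘new i = cong u₀ (strictlyInverseʳ (inj₂ i))
        map-u∘old : ∀ x → map u (map old x) ≡ map (fun l) x
        map-u∘old x = trans (sym (map-∘ x)) (map-cong u∘old x)
        open ≡-Reasoning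
        map-k-word : ∀ i → map (fun k) (map (i ,_) (map inject₁ (allFin (arity i)))) ≡ map u (map old (word i))
        map-k-word i = begin
          map (fun k) (map (i ,_) (map inject₁ (allFin (arity i)))) ≡⟨ cong (map (fun k)) (map-∘ _) ⟨
          map (fun k) (map (λ a → i , inject₁ a) (allFin (arity i))) ≡⟨ map-∘ _ ⟨
          map (λ a → fun k (i , inject₁ a)) (allFin (arity i))       ≡⟨ map-cong (λ a → k∘h≈l∘spell (i , a)) _ ⟩
          map (fun l ∘ lookup (word i)) (allFin (arity i))           ≡⟨ map-∘ _ ⟩
          map (fun l) (map (lookup (word i)) (allFin (arity i)))     ≡⟨ cong (map (fun l)) (map-lookup-allFin (word i)) ⟩
          map (fun l) (word i)                                       ≡⟨ map-u∘old (word i) ⟨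
          map u (map old (word i))                                   ∎
        preserves′ : ∀ {x y} → ExtRel x y → Rl E (map u x) (map u y)
        preserves′ reflexive = isRefl E _
        preserves′ (inherited {x} {y} r) = subst₂ (Rl E) (sym (map-u∘old x)) (sym (map-u∘old y)) (preserves l r)
        preserves′ (defining i) = subst₂ (Rl E) (map-k-word i) (cong [_] (sym (u∘new i)))
          (preserves k (Coproduct.summand {X = B} i (inj₂ (here refl))))
        u∘g′ : ∀ t → u (uncurry name t) ≡ fun k t
        u∘g′ (i , y) with lower? y in eq
        ... | just a = trans (u∘old _) (trans (sym (k∘h≈l∘spell (i , a))) (cong (λ z → fun k (i , z)) (lower?-just y eq)))
        ... | nothing = trans (u∘new i) (cong (λ z → fun k (i , z)) (lower?-nothing y eq))
        unique : ∀ u′ → (u′ ∘H g′) ≈H k → (u′ ∘H extend) ≈H l → ∀ x → fun u′ x ≡ u x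
        unique u′ u′∘g′≈k u′∘old≈l x = trans (cong (fun u′) (sym (strictlyInverseˡ x))) (on-tags (from x))
          where
          on-tags : ∀ t → fun u′ (to t) ≡ u₀ t
          on-tags (inj₁ c) = u′∘old≈l c
          on-tags (inj₂ i) = trans (cong (fun u′) (sym (name-fromℕ i))) (u′∘g′≈k (i , fromℕ (arity i)))

  extend-cell : Cell extend
  extend-cell = pushout h spell extend g′
    (coprod (λ i → incl₁ (arity i)) (λ i → base (j₁ (arity i))) CA.ι CB.ι CA.isCoproduct CB.isCoproduct h (λ _ _ → refl))
    isPushout

module AddRelations (C : RPres) {I : Set} (k : I → ℕ) (rs extra : ∀ i → List (List (Fin (k i)) × List (Fin (k i))))
  (cells : ∀ i → Cell (inclRel (k i) (rs i) (extra i))) (g : ∀ i → Hom ⟨ k i ∣ rs i ⟩ C) where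

  data ExtRel : List (Gn C) → List (Gn C) → Set where
    inherited : ∀ {x y} → Rl C x y → ExtRel x y
    imposed : ∀ i {u v} → (u , v) ∈ extra i → ExtRel (map (fun (g i)) u) (map (fun (g i)) v)

  D : RPres
  D = mkRPres (Gn C) ExtRel (inherited ∘ isRefl C)

  extend : Hom C D
  extend = record
    { fun = λ c → c
    ; preserves = λ {x} {y} r → inherited (subst₂ (Rl C) (sym (map-id x)) (sym (map-id y)) r) }

  ExtRel-sound : ∀ {x y} → ExtRel x y → Cong C x y
  ExtRel-sound (inherited r) = rel r
  ExtRel-sound (imposed i {u} {v} r) = Cong-map⁺ (g i) (IsTietze.map-reflects (Cell⇒tietze (cells i))
    (subst₂ (Cong ⟨ k i ∣ rs i ++ extra i ⟩) (sym (map-id u)) (sym (map-id v)) (rel (inj₂ (∈-++⁺ʳ (rs i) r)))))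

  private
    A B : I → RPres
    A i = ⟨ k i ∣ rs i ⟩
    B i = ⟨ k i ∣ rs i ++ extra i ⟩
    module CA = Coproduct A
    module CB = Coproduct B

    h : Hom CA.∐ CB.∐
    h = CA.copair (λ i → CB.ι i ∘H inclRel (k i) (rs i) (extra i))

    gHom : ∀ i → Hom (B i) D
    gHom i = record { fun = fun (g i) ; preserves = preserves′ }
      where
      preserves′ : ∀ {u v} → Rl (B i) u v → ExtRel (map (fun (g i)) u) (map (fun (g i)) v)
      preserves′ (inj₁ refl) = inherited (isRefl C _)
      preserves′ (inj₂ r) with ∈-++⁻ (rs i) r
      ... | inj₁ r∈rs = inherited (preserves (g i) (inj₂ r∈rs))
      ... | inj₂ r∈extra = imposed i r∈extra

    g′ : Hom CB.∐ D
    g′ = CB.copair gHom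

    isPushout : IsPushout h (CA.copair g) extend g′
    isPushout = (λ _ → refl) , universal
      where
      universal : ∀ E (k′ : Hom CB.∐ E) (l : Hom C E) → (k′ ∘H h) ≈H (l ∘H CA.copair g) →
        Σ (Hom D E) λ u → ((u ∘H g′) ≈H k′) × ((u ∘H extend) ≈H l) ×
          (∀ u′ → (u′ ∘H g′) ≈H k′ → (u′ ∘H extend) ≈H l → u′ ≈H u)
      universal E k′ l k′∘h≈l∘g = record { fun = fun l ; preserves = preserves′ } ,
        (λ t → sym (k′∘h≈l∘g t)) , (λ _ → refl) , (λ u′ _ u′≈l → u′≈l)
        where
        preserves′ : ∀ {x y} → ExtRel x y → Rl E (map (fun l) x) (map (fun l) y)
        preserves′ (inherited r) = preserves l r
        preserves′ (imposed i {u} {v} r) = subst₂ (Rl E) (square u) (square v)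
          (preserves k′ (Coproduct.summand {X = B} i (inj₂ (∈-++⁺ʳ (rs i) r))))
          where
          square : ∀ z → map (fun k′) (map (i ,_) z) ≡ map (fun l) (map (fun (g i)) z)
          square z = trans (sym (map-∘ z)) (trans (map-cong (λ a → k′∘h≈l∘g (i , a)) z) (map-∘ z))

  extend-cell : Cell extend
  extend-cell = pushout h (CA.copair g) extend g′
    (coprod (λ i → inclRel (k i) (rs i) (extra i)) cells CA.ι CB.ι CA.isCoproduct CB.isCoproduct h (λ _ _ → refl))
    isPushout

module _ {A : Set} where

  map-++ᵛ-↑ˡ : ∀ {m n} (xs : Fin m → A) (ys : Fin n → A) l → map (xs ++ᵛ ys) (map (_↑ˡ n) l) ≡ map xs l
  map-++ᵛ-↑ˡ xs ys l = trans (sym (map-∘ l)) (map-cong (lookup-++ˡ xs ys) l)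

  map-++ᵛ-↑ʳ : ∀ {m n} (xs : Fin m → A) (ys : Fin n → A) l → map (xs ++ᵛ ys) (map (m ↑ʳ_) l) ≡ map ys l
  map-++ᵛ-↑ʳ xs ys l = trans (sym (map-∘ l)) (map-cong (lookup-++ʳ xs ys) l)

  assign₂ : (x y : List A) → Fin (length x + length y) → A
  assign₂ x y = lookup x ++ᵛ lookup y

  assign₃ : (x y z : List A) → Fin (length x + length y + length z) → A
  assign₃ x y z = assign₂ x y ++ᵛ lookup z

  assign₄ : (x y w w′ : List A) → Fin (length x + length y + length w + length w′) → A
  assign₄ x y w w′ = assign₃ x y w ++ᵛ lookup w′

  assign₂-u : ∀ x y → map (assign₂ x y) (u₂ (length x) (length y)) ≡ x
  assign₂-u x y = trans (map-++ᵛ-↑ˡ _ _ _) (map-lookup-allFin x)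

  assign₂-v : ∀ x y → map (assign₂ x y) (v₂ (length x) (length y)) ≡ y
  assign₂-v x y = trans (map-++ᵛ-↑ʳ _ _ _) (map-lookup-allFin y)

  assign₃-u : ∀ x y z → map (assign₃ x y z) (u₃ (length x) (length y) (length z)) ≡ x
  assign₃-u x y z = trans (map-++ᵛ-↑ˡ _ _ _) (assign₂-u x y)

  assign₃-v : ∀ x y z → map (assign₃ x y z) (v₃ (length x) (length y) (length z)) ≡ y
  assign₃-v x y z = trans (map-++ᵛ-↑ˡ _ _ _) (assign₂-v x y)

  assign₃-w : ∀ x y z → map (assign₃ x y z) (w₃ (length x) (length y) (length z)) ≡ z
  assign₃-w x y z = trans (map-++ᵛ-↑ʳ _ _ _) (map-lookup-allFin z)

  assign₄-u : ∀ x y w w′ → map (assign₄ x y w w′) (u₄ (length x) (length y) (length w) (length w′)) ≡ x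
  assign₄-u x y w w′ = trans (map-++ᵛ-↑ˡ _ _ _) (assign₃-u x y w)

  assign₄-v : ∀ x y w w′ → map (assign₄ x y w w′) (v₄ (length x) (length y) (length w) (length w′)) ≡ y
  assign₄-v x y w w′ = trans (map-++ᵛ-↑ˡ _ _ _) (assign₃-v x y w)

  assign₄-context : ∀ x y w w′ t → map (assign₄ x y w w′) (w₄ (length x) (length y) (length w) (length w′) ++ t ++ w'₄ (length x) (length y) (length w) (length w′))
    ≡ w ++ map (assign₄ x y w w′) t ++ w′
  assign₄-context x y w w′ t = begin
    map a (w₄ m n p q ++ t ++ w'₄ m n p q)                 ≡⟨ map-++ a (w₄ m n p q) _ ⟩
    map a (w₄ m n p q) ++ map a (t ++ w'₄ m n p q)         ≡⟨ cong (map a (w₄ m n p q) ++_) (map-++ a t _) ⟩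
    map a (w₄ m n p q) ++ map a t ++ map a (w'₄ m n p q)   ≡⟨ cong₂ (λ l r → l ++ map a t ++ r)
                                                                (trans (map-++ᵛ-↑ˡ _ _ _) (assign₃-w x y w))
                                                                (trans (map-++ᵛ-↑ʳ _ _ _) (map-lookup-allFin w′)) ⟩
    w ++ map a t ++ w′                                     ∎
    where
    open ≡-Reasoning
    a = assign₄ x y w w′
    m = length x ; n = length y ; p = length w ; q = length w′

module ClosureStep (C : RPres) where

  data Rule : Set where
    symmetry : ∀ x y → Rl C x y → Rule
    transitivity : ∀ x y z → Rl C x y → Rl C y z → Rule
    context : ∀ (w : List (Gn C)) x y (w′ : List (Gn C)) → Rl C x y → Rule

  arity : Rule → ℕ
  arity (symmetry x y _) = length x + length y
  arity (transitivity x y z _ _) = length x + length y + length z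
  arity (context w x y w′ _) = length x + length y + length w + length w′

  premises conclusions : ∀ ρ → List (List (Fin (arity ρ)) × List (Fin (arity ρ)))
  premises (symmetry x y _) = (u₂ (length x) (length y) , v₂ (length x) (length y)) ∷ []
  premises (transitivity x y z _ _) = let m = length x ; n = length y ; p = length z in
    (u₃ m n p , v₃ m n p) ∷ (v₃ m n p , w₃ m n p) ∷ []
  premises (context w x y w′ _) = let m = length x ; n = length y ; p = length w ; q = length w′ in
    (u₄ m n p q , v₄ m n p q) ∷ []
  conclusions (symmetry x y _) = (v₂ (length x) (length y) , u₂ (length x) (length y)) ∷ []
  conclusions (transitivity x y z _ _) = let m = length x ; n = length y ; p = length z in
    (u₃ m n p , w₃ m n p) ∷ []
  conclusions (context w x y w′ _) = let m = length x ; n = length y ; p = length w ; q = length w′ in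
    (w₄ m n p q ++ u₄ m n p q ++ w'₄ m n p q , w₄ m n p q ++ v₄ m n p q ++ w'₄ m n p q) ∷ []

  rule-cell : ∀ ρ → Cell (inclRel (arity ρ) (premises ρ) (conclusions ρ))
  rule-cell (symmetry x y _) = base (j₃ (length x) (length y))
  rule-cell (transitivity x y z _ _) = base (j₄ (length x) (length y) (length z))
  rule-cell (context w x y w′ _) = base (j₅ (length x) (length y) (length w) (length w′))

  assignment : ∀ ρ → Fin (arity ρ) → Gn C
  assignment (symmetry x y _) = assign₂ x y
  assignment (transitivity x y z _ _) = assign₃ x y z
  assignment (context w x y w′ _) = assign₄ x y w w′

  instantiate : ∀ ρ → Hom ⟨ arity ρ ∣ premises ρ ⟩ C
  instantiate ρ = record { fun = assignment ρ ; preserves = preserves′ ρ }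
    where
    preserves′ : ∀ ρ {u v} → Rl ⟨ arity ρ ∣ premises ρ ⟩ u v → Rl C (map (assignment ρ) u) (map (assignment ρ) v)
    preserves′ ρ (inj₁ refl) = isRefl C _
    preserves′ (symmetry x y r) (inj₂ (here refl)) = subst₂ (Rl C) (sym (assign₂-u x y)) (sym (assign₂-v x y)) r
    preserves′ (transitivity x y z r _) (inj₂ (here refl)) =
      subst₂ (Rl C) (sym (assign₃-u x y z)) (sym (assign₃-v x y z)) r
    preserves′ (transitivity x y z _ r) (inj₂ (there (here refl))) =
      subst₂ (Rl C) (sym (assign₃-v x y z)) (sym (assign₃-w x y z)) r
    preserves′ (context w x y w′ r) (inj₂ (here refl)) =
      subst₂ (Rl C) (sym (assign₄-u x y w w′)) (sym (assign₄-v x y w w′)) r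

  open AddRelations C arity premises conclusions rule-cell instantiate public

  step-symmetric : ∀ {x y} → Rl C x y → ExtRel y x
  step-symmetric {x} {y} r =
    subst₂ ExtRel (assign₂-v x y) (assign₂-u x y) (imposed (symmetry x y r) {v₂ (length x) (length y)} {u₂ (length x) (length y)} (here refl))

  step-transitive : ∀ {x y z} → Rl C x y → Rl C y z → ExtRel x z
  step-transitive {x} {y} {z} r s =
    subst₂ ExtRel (assign₃-u x y z) (assign₃-w x y z) (imposed (transitivity x y z r s) {u₃ (length x) (length y) (length z)} {w₃ (length x) (length y) (length z)} (here refl))

  step-context : ∀ {x y} w w′ → Rl C x y → ExtRel (w ++ x ++ w′) (w ++ y ++ w′)
  step-context {x} {y} w w′ r =
    subst₂ ExtRel (trans (assign₄-context x y w w′ (u₄ m n p q)) (cong (λ t → w ++ t ++ w′) (assign₄-u x y w w′)))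
                  (trans (assign₄-context x y w w′ (v₄ m n p q)) (cong (λ t → w ++ t ++ w′) (assign₄-v x y w w′)))
                  instance′
    where
    m = length x
    n = length y
    p = length w
    q = length w′
    instance′ : ExtRel (map (assign₄ x y w w′) (w₄ m n p q ++ u₄ m n p q ++ w'₄ m n p q))
                       (map (assign₄ x y w w′) (w₄ m n p q ++ v₄ m n p q ++ w'₄ m n p q))
    instance′ = imposed (context w x y w′ r) (here refl)

module Saturation (C : RPres) where

  -- Every stage has generator type Gn C definitionally, which `stage (suc n) = ClosureStep.D (stage n)`
  -- would not give for variable n.
  mutual
    stage : ℕ → RPres
    stage n = mkRPres (Gn C) (StageRel n) (StageRel-refl n)

    StageRel : ℕ → List (Gn C) → List (Gn C) → Set
    StageRel zero = Rl C
    StageRel (suc n) = ClosureStep.ExtRel (stage n)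

    StageRel-refl : ∀ n u → StageRel n u u
    StageRel-refl zero = isRefl C
    StageRel-refl (suc n) u = ClosureStep.inherited (StageRel-refl n u)

  step : ∀ n → Hom (stage n) (stage (suc n))
  step n = ClosureStep.extend (stage n)

  StageRel-sound : ∀ n {x y} → StageRel n x y → Cong C x y
  StageRel-sound zero r = rel r
  StageRel-sound (suc n) r = Cong⁺ (λ x → x) (λ _ _ → refl) (StageRel-sound n) (ClosureStep.ExtRel-sound (stage n) r)

  StageRel-mono : ∀ {n m} → n ≤′ m → ∀ {x y} → StageRel n x y → StageRel m x y
  StageRel-mono ≤′-refl r = r
  StageRel-mono (≤′-step n≤m) r = ClosureStep.inherited (StageRel-mono n≤m r)

  Cong⇒StageRel : ∀ {x y} → Cong C x y → Σ ℕ λ n → StageRel n x y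
  Cong⇒StageRel (rel r) = 0 , r
  Cong⇒StageRel ∼refl = 0 , isRefl C _
  Cong⇒StageRel (∼sym c) with Cong⇒StageRel c
  ... | n , r = suc n , ClosureStep.step-symmetric (stage n) r
  Cong⇒StageRel (∼trans c d) with Cong⇒StageRel c | Cong⇒StageRel d
  ... | n , r | n′ , r′ = suc (n ⊔ n′) , ClosureStep.step-transitive (stage (n ⊔ n′))
    (StageRel-mono (≤⇒≤′ (m≤m⊔n n n′)) r) (StageRel-mono (≤⇒≤′ (m≤n⊔m n n′)) r′)
  Cong⇒StageRel (∼ctx w w′ c) with Cong⇒StageRel c
  ... | n , r = suc n , ClosureStep.step-context (stage n) w w′ r

  module _ {R : List (Gn C) → List (Gn C) → Set} (R-refl : ∀ u → R u u)
           (complete : ∀ {x y} → Cong C x y → R x y) (sound : ∀ {x y} → R x y → Cong C x y) where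

    private
      L : RPres
      L = mkRPres (Gn C) R R-refl

    cocone : ∀ n → Hom (stage n) L
    cocone n = record
      { fun = λ x → x
      ; preserves = λ {x} {y} r → subst₂ R (sym (map-id x)) (sym (map-id y)) (complete (StageRel-sound n r)) }

    isSeqColimit : IsSeqColimit stage step cocone
    isSeqColimit = (λ _ _ → refl) , universal
      where
      universal : ∀ E (k : ∀ n → Hom (stage n) E) → (∀ n → (k (suc n) ∘H step n) ≈H k n) →
        Σ (Hom L E) λ u → (∀ n → (u ∘H cocone n) ≈H k n) × (∀ u′ → (∀ n → (u′ ∘H cocone n) ≈H k n) → u′ ≈H u)
      universal E k k-compatible = record { fun = fun (k 0) ; preserves = preserves′ } ,
        (λ n x → sym (k≈k₀ n x)) , (λ u′ u′≈k → u′≈k 0)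
        where
        k≈k₀ : ∀ n x → fun (k n) x ≡ fun (k 0) x
        k≈k₀ zero x = refl
        k≈k₀ (suc n) x = trans (k-compatible n x) (k≈k₀ n x)
        preserves′ : ∀ {x y} → R x y → Rl E (map (fun (k 0)) x) (map (fun (k 0)) y)
        preserves′ {x} {y} r with Cong⇒StageRel (sound r)
        ... | n , r′ = subst₂ (Rl E) (map-cong (k≈k₀ n) x) (map-cong (k≈k₀ n) y) (preserves (k n) r′)

closure-cell : ∀ (C : RPres) {R : List (Gn C) → List (Gn C) → Set} (R-refl : ∀ u → R u u) →
  (∀ {x y} → Cong C x y → R x y) → (∀ {x y} → R x y → Cong C x y) → Σ (Hom C (mkRPres (Gn C) R R-refl)) Cell
closure-cell C R-refl complete sound =
  cocone R-refl complete sound 0 , ωcomp stage step (λ n → ClosureStep.extend-cell (stage n)) (cocone R-refl complete sound)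
                   (isSeqColimit R-refl complete sound)
  where open Saturation C

subst-reflects : ∀ {C D Q : RPres} {f : Hom C D} → IsTietze f → (θ : Subst D Q) (F : List (Gn C) → List (Gn Q)) →
  (∀ z → Cong Q (θ ⟪ map (fun f) z ⟫) (F z)) → (∀ {z z′} → Cong Q (F z) (F z′) → Cong C z z′) →
  ∀ {x y} → Cong Q (θ ⟪ x ⟫) (θ ⟪ y ⟫) → Cong D x y
subst-reflects {f = f} T θ F θ∘f∼F F-reflects {x} {y} θx∼θy =
  ∼trans (T.map-inverse x) (∼trans (Cong-map⁺ f (F-reflects (∼trans (∼sym (θ-inverse x)) (∼trans θx∼θy (θ-inverse y)))))
                                   (∼sym (T.map-inverse y)))
  where
  module T = IsTietze T
  θ-inverse : ∀ x → Cong _ (θ ⟪ x ⟫) (F (T.inverse ⟪ x ⟫))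
  θ-inverse x = ∼trans (Cong-subst⁺ θ (T.map-inverse x)) (θ∘f∼F (T.inverse ⟪ x ⟫))

module FromIsomorphism (P Q : RPres) (φ : List (Gn P) → List (Gn Q))
  (iso : MonoidMorphisms.IsMonoidIsomorphism (Presented P) (Presented Q) φ) where

  open MonoidMorphisms.IsMonoidIsomorphism iso

  θ : Gn P ⊎ Gn Q → List (Gn Q)
  θ = [ (λ a → φ [ a ]) , [_] ]′

  R : RPres
  R = mkRPres (Gn P ⊎ Gn Q) (λ x y → Cong Q (concatMap θ x) (concatMap θ y)) (λ _ → ∼refl)

  φ-concatMap : ∀ x → Cong Q (concatMap (λ a → φ [ a ]) x) (φ x)
  φ-concatMap [] = ∼sym ε-homo
  φ-concatMap (a ∷ x) = ∼trans (++-congˡ (φ [ a ]) (φ-concatMap x)) (∼sym (homo [ a ] x))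

  θ-inj₁ : ∀ x → Cong Q (concatMap θ (map inj₁ x)) (φ x)
  θ-inj₁ x = subst (λ z → Cong Q z (φ x)) (sym (concatMap-map θ inj₁ x)) (φ-concatMap x)

  θ-inj₂ : ∀ x → concatMap θ (map inj₂ x) ≡ x
  θ-inj₂ x = trans (concatMap-map θ inj₂ x) (concatMap-pure x)

  φ-preimage : List (Gn Q) → List (Gn P)
  φ-preimage y = proj₁ (surjective y)

  module ExtP = AddGenerators P (λ b → φ-preimage [ b ]) ↔-refl
  module ExtQ = AddGenerators Q (λ a → φ [ a ]) swap-↔

  θP : Subst ExtP.D Q
  θP = record { fun = θ ; preserves = preserves′ }
    where
    preserves′ : ∀ {x y} → ExtP.ExtRel x y → Cong Q (concatMap θ x) (concatMap θ y)
    preserves′ ExtP.reflexive = ∼refl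
    preserves′ (ExtP.inherited {x} {y} r) = ∼trans (θ-inj₁ x) (∼trans (⟦⟧-cong (rel r)) (∼sym (θ-inj₁ y)))
    preserves′ (ExtP.defining b) = ∼trans (θ-inj₁ (φ-preimage [ b ])) (proj₂ (surjective [ b ]) ∼refl)

  θQ : Subst ExtQ.D Q
  θQ = record { fun = θ ; preserves = preserves′ }
    where
    preserves′ : ∀ {x y} → ExtQ.ExtRel x y → Cong Q (concatMap θ x) (concatMap θ y)
    preserves′ ExtQ.reflexive = ∼refl
    preserves′ (ExtQ.inherited {x} {y} r) = subst₂ (Cong Q) (sym (θ-inj₂ x)) (sym (θ-inj₂ y)) (rel r)
    preserves′ (ExtQ.defining a) = ≡⇒∼ (trans (θ-inj₂ (φ [ a ])) (sym (++-identityʳ (φ [ a ]))))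

  P→R : Σ (Hom P R) Cell
  P→R = proj₁ closure ∘H ExtP.extend , comp ExtP.extend-cell (proj₂ closure)
    where
    closure : Σ (Hom ExtP.D R) Cell
    closure = closure-cell ExtP.D (λ _ → ∼refl) (Cong-subst⁺ θP)
      (subst-reflects (Cell⇒tietze ExtP.extend-cell) θP φ θ-inj₁ injective)

  Q→R : Σ (Hom Q R) Cell
  Q→R = proj₁ closure ∘H ExtQ.extend , comp ExtQ.extend-cell (proj₂ closure)
    where
    closure : Σ (Hom ExtQ.D R) Cell
    closure = closure-cell ExtQ.D (λ _ → ∼refl) (Cong-subst⁺ θQ)
      (subst-reflects (Cell⇒tietze ExtQ.extend-cell) θQ (λ y → y) (≡⇒∼ ∘ θ-inj₂) (λ c → c))

mainTheorem2 : (P Q : RPres) →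
    MonoidIso P Q ⇔ Σ RPres (λ R → Σ (Hom P R) (λ f → Σ (Hom Q R) (λ g → Cell f × Cell g)))
mainTheorem2 P Q = mk⇔ cospan iso
  where
  cospan : MonoidIso P Q → Σ RPres (λ R → Σ (Hom P R) (λ f → Σ (Hom Q R) (λ g → Cell f × Cell g)))
  cospan (φ , isIso) = R , proj₁ P→R , proj₁ Q→R , proj₂ P→R , proj₂ Q→R
    where open FromIsomorphism P Q φ isIso
  iso : Σ RPres (λ R → Σ (Hom P R) (λ f → Σ (Hom Q R) (λ g → Cell f × Cell g))) → MonoidIso P Q
  iso (R , f , g , f-cell , g-cell) = tietze-cospan⇒iso (Cell⇒tietze f-cell) (Cell⇒tietze g-cell)
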